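{- The specialisations $W(-x,x)$ and $W(-x^{ -1},x)$ of $W(t,x)=\sum_{n\geq0}w_n(t)x^n$ are well defined elements of $\mathbb{Z}[[x]]$ (only finitely many terms contribute to each power of $x$), and $W(-x,x)=1$ and $W(-x^{ -1},x)=0$.
   Context: For $n\geq 0$ let $P_n$ be a strictly convex polygon with $n+2$ vertices and a marked boundary edge $e_*$. A triangulation of $P_n$ is a decomposition into $n$ non-overlapping triangles with vertices among those of $P_n$. Its checkerboard colouring colours each triangle black or white such that the unique triangle containing $e_*$ is black and triangles sharing an edge have different colours; $n_b(\tau),n_w(\tau)$ are the numbers of black and white triangles. Define the Laurent polynomial $w_n(t)=\sum_{\tau}t^{n_b(\tau)-n_w(\tau)}$ over all triangulations $\tau$ of $P_n$, with $w_0=1$. -}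

module Defs where

open import Data.Nat using (ℕ; zero; suc; _%_)
open import Data.Integer using (ℤ; +_; -_; _+_; _-_; _*_; ∣_∣; 0ℤ; 1ℤ)
open import Data.List using (List; []; _∷_; concatMap; map; upTo)
open import Data.Bool using (Bool; true; false; not; if_then_else_)
open import Relation.Nullary.Decidable using (⌊_⌋)
import Data.Nat as ℕ
import Data.Integer as ℤ

-- Triangulations of a convex polygon with a marked boundary edge.
--
-- Label the vertices of the convex polygon v₀,…,v_{m} in cyclic order,
-- with marked edge e_* = v₀v_m.  A triangulation is either
--   * `edge`      : the degenerate polygon with two vertices (no triangles), or
--   * `tri l r`   : the triangle on the marked edge, v₀ v_k v_m (0<k<m),
--                   together with a triangulation `l` of the convex polygon
--                   v₀…v_k (marked edge v₀v_k) and a triangulation `r` of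
--                   v_k…v_m (marked edge v_k v_m).
-- This is the standard recursive description of triangulations of a
-- convex polygon; the polygon of `τ` has `size τ + 2` vertices.

data Triangulation : Set where
  edge : Triangulation
  tri  : Triangulation → Triangulation → Triangulation

size : Triangulation → ℕ
size edge      = 0
size (tri l r) = suc (size l ℕ.+ size r)

-- Checkerboard colouring: the triangle containing the marked edge gets
-- colour `c` (true = black); the sub-triangulations `l`,`r` have their
-- marked-edge triangle sharing an edge with it, so they get `not c`.
-- (In a triangulation of a convex polygon two triangles share an edge
-- exactly when one is the "marked-edge triangle" of a sub-polygon hanging
-- off the other.)
-- `balance c τ` = (#black − #white) triangles.
balance : Bool → Triangulation → ℤ
balance c edge      = 0ℤ
balance c (tri l r) = (if c then 1ℤ else - 1ℤ) + balance (not c) l + balance (not c) r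

nbMinusNw : Triangulation → ℤ
nbMinusNw = balance true

-- Finite enumeration.  `bySize f n` lists the triangulations with exactly
-- n triangles, split at every possible apex (sizes a and n−1−a of the two
-- sub-polygons), using f as recursion fuel; fuel f ≥ n suffices, so
-- `triangulations n = bySize n n` lists every triangulation of P_n
-- (polygon with n+2 vertices) exactly once.

bySize : ℕ → ℕ → List Triangulation
bySize _       zero    = edge ∷ []
bySize zero    (suc n) = []
bySize (suc f) (suc n) =
  concatMap (λ a → concatMap (λ l → map (λ r → tri l r) (bySize f (n ℕ.∸ a)))
                             (bySize f a))
            (upTo (suc n))

triangulations : ℕ → List Triangulation
triangulations n = bySize n n

sumℤ : List ℤ → ℤ
sumℤ []       = 0ℤ
sumℤ (x ∷ xs) = x + sumℤ xs

-- Laurent polynomials in t with ℤ coefficients, represented by their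
-- coefficient function k ↦ [t^k].

LaurentCoeffs : Set
LaurentCoeffs = ℤ → ℤ

w : ℕ → LaurentCoeffs
w n k = sumℤ (map (λ τ → if ⌊ nbMinusNw τ ℤ.≟ k ⌋ then 1ℤ else 0ℤ) (triangulations n))

signPow : ℤ → ℤ
signPow k = if ⌊ ∣ k ∣ % 2 ℕ.≟ 0 ⌋ then 1ℤ else - 1ℤ

-- Contribution of the n-th term w_n(t) x^n to the coefficient of x^m
-- after substituting t = −x :  t^k x^n ↦ (−1)^k x^{n+k}, so k = m − n.
termMinusX : ℕ → ℤ → ℤ
termMinusX n m = signPow (m - + n) * w n (m - + n)

-- after substituting t = −x⁻¹ :  t^k x^n ↦ (−1)^k x^{n−k}, so k = n − m.
termMinusXInv : ℕ → ℤ → ℤ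
termMinusXInv n m = signPow (+ n - m) * w n (+ n - m)

sumBelow : ℕ → (ℕ → ℤ) → ℤ
sumBelow zero    f = 0ℤ
sumBelow (suc N) f = sumBelow N f + f N

oneSeries : ℤ → ℤ
oneSeries m = if ⌊ m ℤ.≟ 0ℤ ⌋ then 1ℤ else 0ℤ

zeroSeries : ℤ → ℤ
zeroSeries m = 0ℤ

-- "Σ_n term n is a well-defined series in x (only finitely many n
-- contribute to each power x^m, m ∈ ℤ) and its coefficients equal `target`":
-- for every exponent m there is N with term n m = 0 for all n ≥ N, and
-- Σ_{n<N} term n m = target m.  (Taking m over all of ℤ, this also says
-- that no negative powers of x occur when target m = 0 for m < 0, i.e. the
-- series lies in ℤ[[x]].)
SumsTo : (ℕ → ℤ → ℤ) → (ℤ → ℤ) → Set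
SumsTo term target =
  (m : ℤ) → Σ ℕ λ N → ((n : ℕ) → N ℕ.≤ n → term n m ≡ 0ℤ)
                     × (sumBelow N (λ n → term n m) ≡ target m)
  where
  open import Data.Product using (Σ; _×_)
  open import Relation.Binary.PropositionalEquality using (_≡_)

-- Let B(x, y) = Σ_τ x^{n_b(τ)} y^{n_w(τ)}, the triangle on e_* being black.
-- Removing that triangle leaves two triangulations whose marked triangles are
-- white, so F(u) = B(u, −1) and G(u) = B(−1, u) satisfy F = 1 + u G² and
-- G = 1 − F², whose only solution in ℤ[[u]] is F = 1, G = 0 (induction on the
-- exponent of u).  Substituting t = −x turns t^{n_b−n_w} x^{n_b+n_w} into
-- (−x²)^{n_b} (−1)^{n_w}, and t = −x⁻¹ turns it into (−1)^{n_b} (−x²)^{n_w};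
-- hence W(−x, x) = F(−x²) = 1 and W(−x⁻¹, x) = G(−x²) = 0.  Every coefficient
-- is a finite sum because a triangulation with n_b = k has at most 3k
-- triangles and one with n_w = k at most 3k + 1.

module Submission where

open import Defs
open import Data.Bool using (Bool; true; false; not; if_then_else_)
open import Data.List using (List; _∷_; []; _++_; map; concatMap; upTo; applyUpTo)
import Data.List.Properties as Listₚ
open import Data.Nat as ℕ using (ℕ; zero; suc; pred; _∸_; _≤_; _<_; z≤n; s≤s)
import Data.Nat.Properties as ℕₚ
open import Data.Nat.DivMod using (_%_; _/_; m≡m%n+[m/n]*n; m*n%n≡0)
open import Data.Nat.Induction using (<-rec)
import Data.Nat.Tactic.RingSolver as ℕ-Solver
open import Data.Integer as ℤ using (ℤ; +_; -[1+_]; -_; _+_; _-_; _*_; _^_; _⊖_; 0ℤ; 1ℤ; -1ℤ)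
import Data.Integer.Properties as ℤₚ
open import Data.Integer.Tactic.RingSolver using (solve-∀)
open import Data.Product using (Σ; _×_; _,_; proj₁; proj₂)
open import Data.Sum using (_⊎_; inj₁; inj₂)
open import Relation.Nullary using (Dec; yes; no; ¬_; contradiction)
open import Relation.Nullary.Decidable using (⌊_⌋)
open import Relation.Binary.PropositionalEquality
open ≡-Reasoning

private
  variable
    A P Q : Set

if-yes : (p? : Dec P) {a b : A} → P → (if ⌊ p? ⌋ then a else b) ≡ a
if-yes (yes _) _ = refl
if-yes (no ¬p) p = contradiction p ¬p

if-no : (p? : Dec P) {a b : A} → ¬ P → (if ⌊ p? ⌋ then a else b) ≡ b
if-no (yes p) ¬p = contradiction p ¬p
if-no (no _)  _  = refl

if-⇔ : (p? : Dec P) (q? : Dec Q) → (P → Q) → (Q → P) → {a b : A} →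
  (if ⌊ p? ⌋ then a else b) ≡ (if ⌊ q? ⌋ then a else b)
if-⇔ (yes _) (yes _) _    _    = refl
if-⇔ (no _)  (no _)  _    _    = refl
if-⇔ (yes p) (no ¬q) P→Q _    = contradiction (P→Q p) ¬q
if-⇔ (no ¬p) (yes q) _    Q→P = contradiction (Q→P q) ¬p

if-*ˡ : ∀ (d : Bool) (a x : ℤ) → (if d then a * x else 0ℤ) ≡ a * (if d then x else 0ℤ)
if-*ˡ true  a x = refl
if-*ˡ false a x = sym (ℤₚ.*-zeroʳ a)

indicator-transfer : (p? : Dec P) (q? : Dec Q) (a b c : ℤ) →
  (P → Q) → (Q → P) → (P → a ≡ c * b) →
  a * (if ⌊ p? ⌋ then 1ℤ else 0ℤ) ≡ c * (if ⌊ q? ⌋ then b else 0ℤ)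
indicator-transfer (yes p) (yes _) a b c _   _   a≡cb = trans (ℤₚ.*-identityʳ _) (a≡cb p)
indicator-transfer (yes p) (no ¬q) a b c P→Q _   _    = contradiction (P→Q p) ¬q
indicator-transfer (no ¬p) (yes q) a b c _   Q→P _    = contradiction (Q→P q) ¬p
indicator-transfer (no _)  (no _)  a b c _   _   _    = trans (ℤₚ.*-zeroʳ a) (sym (ℤₚ.*-zeroʳ c))

-- Sums over lists

sumℤ-++ : ∀ xs ys → sumℤ (xs ++ ys) ≡ sumℤ xs + sumℤ ys
sumℤ-++ []       ys = sym (ℤₚ.+-identityˡ _)
sumℤ-++ (x ∷ xs) ys = trans (cong (_+_ (x)) (sumℤ-++ xs ys)) (sym (ℤₚ.+-assoc x _ _))

sumℤ-cong : ∀ {f g : A → ℤ} xs → (∀ x → f x ≡ g x) → sumℤ (map f xs) ≡ sumℤ (map g xs)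
sumℤ-cong []       f≗g = refl
sumℤ-cong (x ∷ xs) f≗g = cong₂ _+_ (f≗g x) (sumℤ-cong xs f≗g)

sumℤ-0 : (xs : List A) → sumℤ (map (λ _ → 0ℤ) xs) ≡ 0ℤ
sumℤ-0 []       = refl
sumℤ-0 (x ∷ xs) = trans (ℤₚ.+-identityˡ _) (sumℤ-0 xs)

sumℤ-*ˡ : ∀ a (f : A → ℤ) xs → sumℤ (map (λ x → a * f x) xs) ≡ a * sumℤ (map f xs)
sumℤ-*ˡ a f []       = sym (ℤₚ.*-zeroʳ a)
sumℤ-*ˡ a f (x ∷ xs) = trans (cong (_+_ (a * f x)) (sumℤ-*ˡ a f xs)) (sym (ℤₚ.*-distribˡ-+ a (f x) _))

sumℤ-*ʳ : ∀ a (f : A → ℤ) xs → sumℤ (map (λ x → f x * a) xs) ≡ sumℤ (map f xs) * a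
sumℤ-*ʳ a f []       = refl
sumℤ-*ʳ a f (x ∷ xs) = trans (cong (_+_ (f x * a)) (sumℤ-*ʳ a f xs)) (sym (ℤₚ.*-distribʳ-+ a (f x) _))

sumℤ-concatMap : ∀ {B : Set} (g : B → ℤ) (F : A → List B) xs →
  sumℤ (map g (concatMap F xs)) ≡ sumℤ (map (λ x → sumℤ (map g (F x))) xs)
sumℤ-concatMap g F []       = refl
sumℤ-concatMap g F (x ∷ xs) = begin
  sumℤ (map g (F x ++ concatMap F xs))
    ≡⟨ cong sumℤ (Listₚ.map-++ g (F x) (concatMap F xs)) ⟩
  sumℤ (map g (F x) ++ map g (concatMap F xs))
    ≡⟨ sumℤ-++ (map g (F x)) _ ⟩
  sumℤ (map g (F x)) + sumℤ (map g (concatMap F xs))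
    ≡⟨ cong (_+_ (sumℤ (map g (F x)))) (sumℤ-concatMap g F xs) ⟩
  sumℤ (map g (F x)) + sumℤ (map (λ x → sumℤ (map g (F x))) xs) ∎

sumℤ-bilinear : ∀ {B : Set} (f : A → ℤ) (g : B → ℤ) xs ys →
  sumℤ (map (λ x → sumℤ (map (λ y → f x * g y) ys)) xs) ≡ sumℤ (map f xs) * sumℤ (map g ys)
sumℤ-bilinear f g xs ys =
  trans (sumℤ-cong xs (λ x → sumℤ-*ˡ (f x) g ys)) (sumℤ-*ʳ (sumℤ (map g ys)) f xs)

-- Sums over initial segments of ℕ

sumBelow-cong : ∀ N {f g : ℕ → ℤ} → (∀ i → i < N → f i ≡ g i) → sumBelow N f ≡ sumBelow N g
sumBelow-cong zero    f≗g = refl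
sumBelow-cong (suc N) f≗g =
  cong₂ _+_ (sumBelow-cong N (λ i i<N → f≗g i (ℕₚ.m<n⇒m<1+n i<N))) (f≗g N ℕₚ.≤-refl)

sumBelow-0 : ∀ N → sumBelow N (λ _ → 0ℤ) ≡ 0ℤ
sumBelow-0 zero    = refl
sumBelow-0 (suc N) = trans (ℤₚ.+-identityʳ _) (sumBelow-0 N)

sumBelow-suc : ∀ N (f : ℕ → ℤ) → sumBelow (suc N) f ≡ f 0 + sumBelow N (λ i → f (suc i))
sumBelow-suc zero    f = trans (ℤₚ.+-identityˡ (f 0)) (sym (ℤₚ.+-identityʳ (f 0)))
sumBelow-suc (suc N) f = trans (cong (_+ f (suc N)) (sumBelow-suc N f)) (ℤₚ.+-assoc (f 0) _ _)

sumBelow-+ : ∀ N (f g : ℕ → ℤ) → sumBelow N (λ i → f i + g i) ≡ sumBelow N f + sumBelow N g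
sumBelow-+ zero    f g = refl
sumBelow-+ (suc N) f g =
  trans (cong (_+ (f N + g N)) (sumBelow-+ N f g)) (interchange (sumBelow N f) (sumBelow N g) (f N) (g N))
  where
  interchange : ∀ (a b c d : ℤ) → a + b + (c + d) ≡ a + c + (b + d)
  interchange = solve-∀

sumBelow-*ˡ : ∀ N a (f : ℕ → ℤ) → sumBelow N (λ i → a * f i) ≡ a * sumBelow N f
sumBelow-*ˡ zero    a f = sym (ℤₚ.*-zeroʳ a)
sumBelow-*ˡ (suc N) a f =
  trans (cong (_+ a * f N) (sumBelow-*ˡ N a f)) (sym (ℤₚ.*-distribˡ-+ a (sumBelow N f) (f N)))

sumBelow-*ʳ : ∀ N a (f : ℕ → ℤ) → sumBelow N (λ i → f i * a) ≡ sumBelow N f * a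
sumBelow-*ʳ zero    a f = refl
sumBelow-*ʳ (suc N) a f =
  trans (cong (_+ f N * a) (sumBelow-*ʳ N a f)) (sym (ℤₚ.*-distribʳ-+ a (sumBelow N f) (f N)))

sumBelow-swap : ∀ N M (f : ℕ → ℕ → ℤ) →
  sumBelow N (λ n → sumBelow M (f n)) ≡ sumBelow M (λ i → sumBelow N (λ n → f n i))
sumBelow-swap zero    M f = sym (sumBelow-0 M)
sumBelow-swap (suc N) M f = trans (cong (_+ sumBelow M (f N)) (sumBelow-swap N M f))
                                  (sym (sumBelow-+ M (λ i → sumBelow N (λ n → f n i)) (f N)))

sumℤ-applyUpTo : ∀ M (f : ℕ → ℕ) (g : ℕ → ℤ) →
  sumℤ (map g (applyUpTo f M)) ≡ sumBelow M (λ i → g (f i))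
sumℤ-applyUpTo zero    f g = refl
sumℤ-applyUpTo (suc M) f g = trans (cong (_+_ (g (f 0))) (sumℤ-applyUpTo M (λ i → f (suc i)) g))
                                   (sym (sumBelow-suc M (λ i → g (f i))))

sumℤ-sumBelow : ∀ M (F : ℕ → A → ℤ) xs →
  sumℤ (map (λ x → sumBelow M (λ i → F i x)) xs) ≡ sumBelow M (λ i → sumℤ (map (F i) xs))
sumℤ-sumBelow M F []       = sym (sumBelow-0 M)
sumℤ-sumBelow M F (x ∷ xs) = trans (cong (_+_ (sumBelow M (λ i → F i x))) (sumℤ-sumBelow M F xs))
                                   (sym (sumBelow-+ M (λ i → F i x) (λ i → sumℤ (map (F i) xs))))

sumℤ-linear : ∀ s M (F : ℕ → A → ℤ) xs →
  sumℤ (map (λ x → s * sumBelow M (λ i → F i x)) xs) ≡ s * sumBelow M (λ i → sumℤ (map (F i) xs))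
sumℤ-linear s M F xs = trans (sumℤ-*ˡ s (λ x → sumBelow M (λ i → F i x)) xs)
                             (cong (s *_) (sumℤ-sumBelow M F xs))

sumBelow-δ-out : ∀ M x (a : ℤ) (f : ℕ → ℤ) → M ≤ x →
  sumBelow M (λ i → (if ⌊ x ℕ.≟ i ⌋ then a else 0ℤ) * f i) ≡ 0ℤ
sumBelow-δ-out zero    x a f _   = refl
sumBelow-δ-out (suc M) x a f M<x =
  cong₂ _+_ (sumBelow-δ-out M x a f (ℕₚ.<⇒≤ M<x))
            (cong (_* f M) (if-no (x ℕ.≟ M) (λ x≡M → ℕₚ.<⇒≢ M<x (sym x≡M))))

sumBelow-δ : ∀ M x (a : ℤ) (f : ℕ → ℤ) → x < M →
  sumBelow M (λ i → (if ⌊ x ℕ.≟ i ⌋ then a else 0ℤ) * f i) ≡ a * f x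
sumBelow-δ (suc M) x a f (s≤s x≤M) with ℕₚ.m≤n⇒m<n∨m≡n x≤M
... | inj₂ refl =
  trans (cong₂ _+_ (sumBelow-δ-out M M a f ℕₚ.≤-refl) (cong (_* f M) (if-yes (M ℕ.≟ M) refl)))
        (ℤₚ.+-identityˡ _)
... | inj₁ x<M =
  trans (cong₂ _+_ (sumBelow-δ M x a f x<M) (cong (_* f M) (if-no (x ℕ.≟ M) (ℕₚ.<⇒≢ x<M))))
        (ℤₚ.+-identityʳ _)

indicator-convolution : ∀ x y (a b : ℤ) k →
  (if ⌊ x ℕ.+ y ℕ.≟ k ⌋ then a * b else 0ℤ)
    ≡ sumBelow (suc k) (λ i → (if ⌊ x ℕ.≟ i ⌋ then a else 0ℤ)
                            * (if ⌊ y ℕ.≟ k ∸ i ⌋ then b else 0ℤ))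
indicator-convolution x y a b k with x ℕ.≤? k
... | no x≰k =
  trans (if-no (x ℕ.+ y ℕ.≟ k) (λ x+y≡k → x≰k (subst (x ≤_) x+y≡k (ℕₚ.m≤m+n x y))))
        (sym (sumBelow-δ-out (suc k) x a _ (ℕₚ.≰⇒> x≰k)))
... | yes x≤k = trans first-factor (sym (sumBelow-δ (suc k) x a _ (s≤s x≤k)))
  where
  first-factor : (if ⌊ x ℕ.+ y ℕ.≟ k ⌋ then a * b else 0ℤ)
               ≡ a * (if ⌊ y ℕ.≟ k ∸ x ⌋ then b else 0ℤ)
  first-factor with y ℕ.≟ k ∸ x
  ... | yes y≡k∸x = if-yes (x ℕ.+ y ℕ.≟ k) (trans (cong (x ℕ.+_) y≡k∸x) (ℕₚ.m+[n∸m]≡n x≤k))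
  ... | no  y≢k∸x = trans (if-no (x ℕ.+ y ℕ.≟ k) λ x+y≡k →
                             y≢k∸x (trans (sym (ℕₚ.m+n∸m≡n x y)) (cong (_∸ x) x+y≡k)))
                          (sym (ℤₚ.*-zeroʳ a))

-- Cauchy products of truncated series

cauchy : ℕ → (ℕ → ℤ) → (ℕ → ℤ) → ℤ
cauchy N f g = sumBelow N (λ n → sumBelow (suc n) (λ a → f a * g (n ∸ a)))

cauchy-reindex : ∀ N f g → cauchy N f g ≡ sumBelow N (λ a → f a * sumBelow (N ∸ a) g)
cauchy-reindex zero    f g = refl
cauchy-reindex (suc N) f g = begin
  cauchy N f g + sumBelow (suc N) (λ a → f a * g (N ∸ a))
    ≡⟨ cong (_+ sumBelow (suc N) (λ a → f a * g (N ∸ a))) (cauchy-reindex N f g) ⟩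
  R + (sumBelow N (λ a → f a * g (N ∸ a)) + f N * g (N ∸ N))
    ≡⟨ sym (ℤₚ.+-assoc R _ _) ⟩
  R + sumBelow N (λ a → f a * g (N ∸ a)) + f N * g (N ∸ N)
    ≡⟨ cong₂ _+_ (sym (sumBelow-+ N _ _)) (cong (f N *_) last-term) ⟩
  sumBelow N (λ a → f a * sumBelow (N ∸ a) g + f a * g (N ∸ a)) + f N * sumBelow (suc N ∸ N) g
    ≡⟨ cong (_+ f N * sumBelow (suc N ∸ N) g) (sumBelow-cong N extend) ⟩
  sumBelow (suc N) (λ a → f a * sumBelow (suc N ∸ a) g) ∎
  where
  R = sumBelow N (λ a → f a * sumBelow (N ∸ a) g)
  last-term : g (N ∸ N) ≡ sumBelow (suc N ∸ N) g
  last-term = begin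
    g (N ∸ N)                ≡⟨ cong g (ℕₚ.n∸n≡0 N) ⟩
    g 0                      ≡⟨ sym (ℤₚ.+-identityˡ (g 0)) ⟩
    sumBelow 1 g             ≡⟨ cong (λ n → sumBelow n g) (sym (ℕₚ.m+n∸n≡m 1 N)) ⟩
    sumBelow (suc N ∸ N) g   ∎
  extend : ∀ a → a < N → f a * sumBelow (N ∸ a) g + f a * g (N ∸ a) ≡ f a * sumBelow (suc N ∸ a) g
  extend a a<N = trans (sym (ℤₚ.*-distribˡ-+ (f a) _ _))
                       (cong (λ n → f a * sumBelow n g) (sym (ℕₚ.+-∸-assoc 1 (ℕₚ.<⇒≤ a<N))))

sumBelow-support : ∀ (g : ℕ → ℤ) B → (∀ b → B < b → g b ≡ 0ℤ) →
  ∀ M → B < M → sumBelow M g ≡ sumBelow (suc B) g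
sumBelow-support g B g-vanishes (suc M) (s≤s B≤M) with ℕₚ.m≤n⇒m<n∨m≡n B≤M
... | inj₂ refl = refl
... | inj₁ B<M  = trans (cong₂ _+_ (sumBelow-support g B g-vanishes M B<M) (g-vanishes M B<M))
                        (ℤₚ.+-identityʳ _)

cauchy-supported : ∀ N f g A B → (∀ a → A < a → f a ≡ 0ℤ) → (∀ b → B < b → g b ≡ 0ℤ) →
  A ℕ.+ B < N → cauchy N f g ≡ sumBelow N f * sumBelow N g
cauchy-supported N f g A B f-vanishes g-vanishes A+B<N = begin
  cauchy N f g                                   ≡⟨ cauchy-reindex N f g ⟩
  sumBelow N (λ a → f a * sumBelow (N ∸ a) g)    ≡⟨ sumBelow-cong N full-inner-sum ⟩
  sumBelow N (λ a → f a * sumBelow N g)          ≡⟨ sumBelow-*ʳ N _ f ⟩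
  sumBelow N f * sumBelow N g                    ∎
  where
  full-inner-sum : ∀ a → a < N → f a * sumBelow (N ∸ a) g ≡ f a * sumBelow N g
  full-inner-sum a a<N with a ℕ.≤? A
  ... | no a≰A = trans (cong (_* sumBelow (N ∸ a) g) fa≡0) (sym (cong (_* sumBelow N g) fa≡0))
    where
    fa≡0 : f a ≡ 0ℤ
    fa≡0 = f-vanishes a (ℕₚ.≰⇒> a≰A)
  ... | yes a≤A = cong (f a *_) (trans (sumBelow-support g B g-vanishes (N ∸ a) B<N∸a)
                                       (sym (sumBelow-support g B g-vanishes N B<N)))
    where
    B<N : B < N
    B<N = ℕₚ.≤-<-trans (ℕₚ.m≤n+m B A) A+B<N
    B<N∸a : B < N ∸ a
    B<N∸a = ℕₚ.m+n≤o⇒m≤o∸n (suc B) (subst (_≤ N) (cong suc (ℕₚ.+-comm a B))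
              (ℕₚ.≤-trans (s≤s (ℕₚ.+-monoˡ-≤ B a≤A)) A+B<N))

-- Sums over the enumeration of triangulations

sumBySize : ℕ → ℕ → (Triangulation → ℤ) → ℤ
sumBySize f n g = sumℤ (map g (bySize f n))

sumBySize-suc : ∀ f n g → sumBySize (suc f) (suc n) g ≡
  sumBelow (suc n) (λ a → sumBySize f a (λ l → sumBySize f (n ∸ a) (λ r → g (tri l r))))
sumBySize-suc f n g = begin
  sumℤ (map g (concatMap split (upTo (suc n))))
    ≡⟨ sumℤ-concatMap g split (upTo (suc n)) ⟩
  sumℤ (map (λ a → sumℤ (map g (split a))) (upTo (suc n)))
    ≡⟨ sumℤ-applyUpTo (suc n) (λ a → a) (λ a → sumℤ (map g (split a))) ⟩
  sumBelow (suc n) (λ a → sumℤ (map g (split a)))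
    ≡⟨ sumBelow-cong (suc n) (λ a _ → split-sum a) ⟩
  sumBelow (suc n) (λ a → sumBySize f a (λ l → sumBySize f (n ∸ a) (λ r → g (tri l r)))) ∎
  where
  split : ℕ → List Triangulation
  split a = concatMap (λ l → map (tri l) (bySize f (n ∸ a))) (bySize f a)
  split-sum : ∀ a →
    sumℤ (map g (split a)) ≡ sumBySize f a (λ l → sumBySize f (n ∸ a) (λ r → g (tri l r)))
  split-sum a = trans (sumℤ-concatMap g _ (bySize f a))
                      (sumℤ-cong (bySize f a) (λ l → cong sumℤ (sym (Listₚ.map-∘ (bySize f (n ∸ a))))))

sumBySize-fuel : ∀ f f' n g → n ≤ f → n ≤ f' → sumBySize f n g ≡ sumBySize f' n g
sumBySize-fuel f       f'       zero    g _         _          = refl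
sumBySize-fuel (suc f) (suc f') (suc n) g (s≤s n≤f) (s≤s n≤f') = begin
  sumBySize (suc f) (suc n) g   ≡⟨ sumBySize-suc f n g ⟩
  _                             ≡⟨ sumBelow-cong (suc n) refuel ⟩
  _                             ≡⟨ sym (sumBySize-suc f' n g) ⟩
  sumBySize (suc f') (suc n) g  ∎
  where
  refuel : ∀ a → a < suc n →
    sumBySize f a (λ l → sumBySize f (n ∸ a) (λ r → g (tri l r)))
      ≡ sumBySize f' a (λ l → sumBySize f' (n ∸ a) (λ r → g (tri l r)))
  refuel a (s≤s a≤n) = trans
    (sumBySize-fuel f f' a _ (ℕₚ.≤-trans a≤n n≤f) (ℕₚ.≤-trans a≤n n≤f'))
    (sumℤ-cong (bySize f' a) λ l →
      sumBySize-fuel f f' (n ∸ a) _ (ℕₚ.≤-trans (ℕₚ.m∸n≤m n a) n≤f) (ℕₚ.≤-trans (ℕₚ.m∸n≤m n a) n≤f'))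

sumBySize-cong : ∀ f n {g h : Triangulation → ℤ} →
  (∀ τ → size τ ≡ n → g τ ≡ h τ) → sumBySize f n g ≡ sumBySize f n h
sumBySize-cong f       zero    g≗h = cong (_+ 0ℤ) (g≗h edge refl)
sumBySize-cong zero    (suc n) g≗h = refl
sumBySize-cong (suc f) (suc n) {g} {h} g≗h = begin
  sumBySize (suc f) (suc n) g  ≡⟨ sumBySize-suc f n g ⟩
  _                            ≡⟨ sumBelow-cong (suc n) split-cong ⟩
  _                            ≡⟨ sym (sumBySize-suc f n h) ⟩
  sumBySize (suc f) (suc n) h  ∎
  where
  split-cong : ∀ a → a < suc n →
    sumBySize f a (λ l → sumBySize f (n ∸ a) (λ r → g (tri l r)))
      ≡ sumBySize f a (λ l → sumBySize f (n ∸ a) (λ r → h (tri l r)))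
  split-cong a (s≤s a≤n) =
    sumBySize-cong f a λ l size-l → sumBySize-cong f (n ∸ a) λ r size-r →
      g≗h (tri l r) (cong suc (trans (cong₂ ℕ._+_ size-l size-r) (ℕₚ.m+[n∸m]≡n a≤n)))

sumTri : ℕ → (Triangulation → ℤ) → ℤ
sumTri n g = sumℤ (map g (triangulations n))

sumTri-cong : ∀ n {g h : Triangulation → ℤ} →
  (∀ τ → size τ ≡ n → g τ ≡ h τ) → sumTri n g ≡ sumTri n h
sumTri-cong n = sumBySize-cong n n

sumTri-suc : ∀ n g →
  sumTri (suc n) g ≡ sumBelow (suc n) (λ a → sumTri a (λ l → sumTri (n ∸ a) (λ r → g (tri l r))))
sumTri-suc n g = trans (sumBySize-suc n n g) (sumBelow-cong (suc n) refuel)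
  where
  refuel : ∀ a → a < suc n →
    sumBySize n a (λ l → sumBySize n (n ∸ a) (λ r → g (tri l r)))
      ≡ sumTri a (λ l → sumTri (n ∸ a) (λ r → g (tri l r)))
  refuel a (s≤s a≤n) = trans
    (sumBySize-fuel n a a _ a≤n ℕₚ.≤-refl)
    (sumℤ-cong (triangulations a) λ l →
      sumBySize-fuel n (n ∸ a) (n ∸ a) _ (ℕₚ.m∸n≤m n a) ℕₚ.≤-refl)

sumTriBelow : ℕ → (Triangulation → ℤ) → ℤ
sumTriBelow N g = sumBelow N (λ n → sumTri n g)

module _ (h : Triangulation → ℤ) (s : ℤ) (M : ℕ) (X Y : ℕ → Triangulation → ℤ)
         (h-tri : ∀ l r → h (tri l r) ≡ s * sumBelow M (λ i → X i l * Y i r)) where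

  sumTri-suc-bilinear : ∀ n → sumTri (suc n) h ≡
    s * sumBelow M (λ i → sumBelow (suc n) (λ a → sumTri a (X i) * sumTri (n ∸ a) (Y i)))
  sumTri-suc-bilinear n = begin
    sumTri (suc n) h
      ≡⟨ sumTri-suc n h ⟩
    sumBelow (suc n) (λ a → sumTri a (λ l → sumTri (n ∸ a) (λ r → h (tri l r))))
      ≡⟨ sumBelow-cong (suc n) (λ a _ → split a) ⟩
    sumBelow (suc n) (λ a → s * sumBelow M (λ i → sumTri a (X i) * sumTri (n ∸ a) (Y i)))
      ≡⟨ sumBelow-*ˡ (suc n) s _ ⟩
    s * sumBelow (suc n) (λ a → sumBelow M (λ i → sumTri a (X i) * sumTri (n ∸ a) (Y i)))
      ≡⟨ cong (s *_) (sumBelow-swap (suc n) M _) ⟩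
    s * sumBelow M (λ i → sumBelow (suc n) (λ a → sumTri a (X i) * sumTri (n ∸ a) (Y i))) ∎
    where
    split : ∀ a → sumTri a (λ l → sumTri (n ∸ a) (λ r → h (tri l r)))
                    ≡ s * sumBelow M (λ i → sumTri a (X i) * sumTri (n ∸ a) (Y i))
    split a = begin
      sumTri a (λ l → sumTri (n ∸ a) (λ r → h (tri l r)))
        ≡⟨ sumℤ-cong (triangulations a) (λ l →
             trans (sumℤ-cong (triangulations (n ∸ a)) (h-tri l))
                   (sumℤ-linear s M (λ i r → X i l * Y i r) (triangulations (n ∸ a)))) ⟩
      sumTri a (λ l → s * sumBelow M (λ i → sumTri (n ∸ a) (λ r → X i l * Y i r)))
        ≡⟨ sumℤ-linear s M (λ i l → sumTri (n ∸ a) (λ r → X i l * Y i r)) (triangulations a) ⟩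
      s * sumBelow M (λ i → sumTri a (λ l → sumTri (n ∸ a) (λ r → X i l * Y i r)))
        ≡⟨ cong (s *_) (sumBelow-cong M λ i _ →
             sumℤ-bilinear (X i) (Y i) (triangulations a) (triangulations (n ∸ a))) ⟩
      s * sumBelow M (λ i → sumTri a (X i) * sumTri (n ∸ a) (Y i)) ∎

  sumTriBelow-suc : ∀ N → sumTriBelow (suc N) h ≡
    h edge + s * sumBelow M (λ i → cauchy N (λ a → sumTri a (X i)) (λ b → sumTri b (Y i)))
  sumTriBelow-suc N = begin
    sumTriBelow (suc N) h
      ≡⟨ sumBelow-suc N (λ n → sumTri n h) ⟩
    (h edge + 0ℤ) + sumBelow N (λ n → sumTri (suc n) h)
      ≡⟨ cong₂ _+_ (ℤₚ.+-identityʳ (h edge)) (sumBelow-cong N (λ n _ → sumTri-suc-bilinear n)) ⟩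
    h edge + sumBelow N (λ n → s * sumBelow M (λ i → term i n))
      ≡⟨ cong (_+_ (h edge)) (trans (sumBelow-*ˡ N s (λ n → sumBelow M (λ i → term i n)))
                                    (cong (s *_) (sumBelow-swap N M (λ n i → term i n)))) ⟩
    h edge + s * sumBelow M (λ i → cauchy N (λ a → sumTri a (X i)) (λ b → sumTri b (Y i))) ∎
    where
    term : ℕ → ℕ → ℤ
    term i n = sumBelow (suc n) (λ a → sumTri a (X i) * sumTri (n ∸ a) (Y i))

-- Colour counts and the coefficients of F and G

-- With the marked triangle black, count true τ = n_b(τ) and count false τ = n_w(τ).
count : Bool → Triangulation → ℕ
count c     edge      = 0
count true  (tri l r) = suc (count false l ℕ.+ count false r)
count false (tri l r) = count true l ℕ.+ count true r

sizeBound : Bool → ℕ → ℕ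
sizeBound true  k = 3 ℕ.* k
sizeBound false k = suc (3 ℕ.* k)

size≤sizeBound : ∀ c τ → size τ ≤ sizeBound c (count c τ)
size≤sizeBound c edge = z≤n
size≤sizeBound true (tri l r) =
  ℕₚ.≤-trans (s≤s (ℕₚ.+-mono-≤ (size≤sizeBound false l) (size≤sizeBound false r)))
             (ℕₚ.≤-reflexive (regroup (count false l) (count false r)))
  where
  regroup : ∀ x y → suc (suc (3 ℕ.* x) ℕ.+ suc (3 ℕ.* y)) ≡ 3 ℕ.* suc (x ℕ.+ y)
  regroup = ℕ-Solver.solve-∀
size≤sizeBound false (tri l r) =
  ℕₚ.≤-trans (s≤s (ℕₚ.+-mono-≤ (size≤sizeBound true l) (size≤sizeBound true r)))
             (ℕₚ.≤-reflexive (cong suc (sym (ℕₚ.*-distribˡ-+ 3 (count true l) (count true r)))))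

*-3-split : ∀ {i k} → i ≤ k → 3 ℕ.* i ℕ.+ 3 ℕ.* (k ∸ i) ≡ 3 ℕ.* k
*-3-split {i} {k} i≤k =
  trans (sym (ℕₚ.*-distribˡ-+ 3 i (k ∸ i))) (cong (3 ℕ.*_) (ℕₚ.m+[n∸m]≡n i≤k))

sizeBound-true-split : ∀ {i k} → i ≤ k →
  suc (sizeBound true i ℕ.+ sizeBound true (k ∸ i)) ≡ sizeBound false k
sizeBound-true-split i≤k = cong suc (*-3-split i≤k)

sizeBound-false-split : ∀ {i k} → i ≤ k →
  suc (sizeBound false i ℕ.+ sizeBound false (k ∸ i)) ≡ sizeBound true (suc k)
sizeBound-false-split {i} {k} i≤k = begin
  suc (suc (3 ℕ.* i) ℕ.+ suc (3 ℕ.* (k ∸ i))) ≡⟨ regroup (3 ℕ.* i) (3 ℕ.* (k ∸ i)) ⟩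
  3 ℕ.+ (3 ℕ.* i ℕ.+ 3 ℕ.* (k ∸ i))           ≡⟨ cong (3 ℕ.+_) (*-3-split i≤k) ⟩
  3 ℕ.+ 3 ℕ.* k                               ≡⟨ sym (ℕₚ.*-suc 3 k) ⟩
  3 ℕ.* suc k                                 ∎
  where
  regroup : ∀ x y → suc (suc x ℕ.+ suc y) ≡ 3 ℕ.+ (x ℕ.+ y)
  regroup = ℕ-Solver.solve-∀

-- Σ_τ weight true k τ and Σ_τ weight false k τ are the coefficients of u^k in F and G.
weight : Bool → ℕ → Triangulation → ℤ
weight c k τ = if ⌊ count c τ ℕ.≟ k ⌋ then -1ℤ ^ count (not c) τ else 0ℤ

weight-tri-convolution : ∀ c k l r →
  (if ⌊ count c l ℕ.+ count c r ℕ.≟ k ⌋ then -1ℤ ^ (count (not c) l ℕ.+ count (not c) r) else 0ℤ)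
    ≡ sumBelow (suc k) (λ i → weight c i l * weight c (k ∸ i) r)
weight-tri-convolution c k l r = trans
  (cong (λ z → if ⌊ count c l ℕ.+ count c r ℕ.≟ k ⌋ then z else 0ℤ)
        (ℤₚ.^-distribˡ-+-* -1ℤ (count (not c) l) (count (not c) r)))
  (indicator-convolution (count c l) (count c r) _ _ k)

-- The factor u in F = 1 + u G² shifts the index by one; for k = 0 the sum is empty.
weight-true-tri : ∀ k l r →
  weight true k (tri l r) ≡ 1ℤ * sumBelow k (λ i → weight false i l * weight false (pred k ∸ i) r)
weight-true-tri zero    l r = refl
weight-true-tri (suc k) l r = begin
  weight true (suc k) (tri l r)
    ≡⟨ if-⇔ (suc (count false l ℕ.+ count false r) ℕ.≟ suc k) (count false l ℕ.+ count false r ℕ.≟ k)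
            ℕₚ.suc-injective (cong suc) ⟩
  (if ⌊ count false l ℕ.+ count false r ℕ.≟ k ⌋ then -1ℤ ^ (count true l ℕ.+ count true r) else 0ℤ)
    ≡⟨ weight-tri-convolution false k l r ⟩
  sumBelow (suc k) (λ i → weight false i l * weight false (k ∸ i) r)
    ≡⟨ sym (ℤₚ.*-identityˡ _) ⟩
  1ℤ * sumBelow (suc k) (λ i → weight false i l * weight false (k ∸ i) r) ∎

weight-false-tri : ∀ k l r →
  weight false k (tri l r) ≡ -1ℤ * sumBelow (suc k) (λ i → weight true i l * weight true (k ∸ i) r)
weight-false-tri k l r =
  trans (if-*ˡ ⌊ count true l ℕ.+ count true r ℕ.≟ k ⌋ -1ℤ (-1ℤ ^ (count false l ℕ.+ count false r)))
        (cong (-1ℤ *_) (weight-tri-convolution true k l r))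

sumTri-weight-beyond : ∀ c k n → sizeBound c k < n → sumTri n (weight c k) ≡ 0ℤ
sumTri-weight-beyond c k n bound = trans (sumTri-cong n vanishes) (sumℤ-0 (triangulations n))
  where
  vanishes : ∀ τ → size τ ≡ n → weight c k τ ≡ 0ℤ
  vanishes τ refl = if-no (count c τ ℕ.≟ k) λ { refl → ℕₚ.<⇒≱ bound (size≤sizeBound c τ) }

cauchy-weights : ∀ c i j N → sizeBound c i ℕ.+ sizeBound c j < N →
  cauchy N (λ a → sumTri a (weight c i)) (λ b → sumTri b (weight c j))
    ≡ sumTriBelow N (weight c i) * sumTriBelow N (weight c j)
cauchy-weights c i j N =
  cauchy-supported N _ _ (sizeBound c i) (sizeBound c j) (sumTri-weight-beyond c i) (sumTri-weight-beyond c j)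

weightTotal : Bool → ℕ → ℤ
weightTotal true  zero    = 1ℤ
weightTotal true  (suc _) = 0ℤ
weightTotal false _       = 0ℤ

weightTotal-true-square : ∀ k →
  sumBelow (suc k) (λ i → weightTotal true i * weightTotal true (k ∸ i)) ≡ weightTotal true k
weightTotal-true-square k = begin
  sumBelow (suc k) (λ i → weightTotal true i * weightTotal true (k ∸ i))
    ≡⟨ sumBelow-suc k _ ⟩
  1ℤ * weightTotal true k + sumBelow k (λ _ → 0ℤ)
    ≡⟨ cong₂ _+_ (ℤₚ.*-identityˡ (weightTotal true k)) (sumBelow-0 k) ⟩
  weightTotal true k + 0ℤ
    ≡⟨ ℤₚ.+-identityʳ _ ⟩
  weightTotal true k ∎

WeightSumsTo : Bool → ℕ → Set
WeightSumsTo c k = ∀ N → sizeBound c k < N → sumTriBelow N (weight c k) ≡ weightTotal c k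

weightSumsTo-true : ∀ k → (∀ {i} → i < k → WeightSumsTo false i) → WeightSumsTo true k
weightSumsTo-true zero    _  (suc N) _ =
  sumTriBelow-suc (weight true 0) 1ℤ 0 (weight false) (weight false) (weight-true-tri 0) N
weightSumsTo-true (suc k) ih (suc N) (s≤s 3+3k≤N) = begin
  sumTriBelow (suc N) (weight true (suc k))
    ≡⟨ sumTriBelow-suc (weight true (suc k)) 1ℤ (suc k) (weight false) (λ i → weight false (k ∸ i))
                       (weight-true-tri (suc k)) N ⟩
  0ℤ + 1ℤ * sumBelow (suc k) (λ i → cauchy N (sums i) (sums (k ∸ i)))
    ≡⟨ cong (λ z → 0ℤ + 1ℤ * z) (trans (sumBelow-cong (suc k) product-vanishes) (sumBelow-0 (suc k))) ⟩
  0ℤ ∎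
  where
  sums : ℕ → ℕ → ℤ
  sums i a = sumTri a (weight false i)
  product-vanishes : ∀ i → i < suc k → cauchy N (sums i) (sums (k ∸ i)) ≡ 0ℤ
  product-vanishes i (s≤s i≤k) =
    trans (cauchy-weights false i (k ∸ i) N within)
          (cong (_* sumTriBelow N (weight false (k ∸ i)))
                (ih (s≤s i≤k) N (ℕₚ.≤-<-trans (ℕₚ.m≤m+n (sizeBound false i) _) within)))
    where
    within : sizeBound false i ℕ.+ sizeBound false (k ∸ i) < N
    within = subst (_≤ N) (sym (sizeBound-false-split i≤k)) 3+3k≤N

weightSumsTo-false : ∀ k → (∀ {i} → i ≤ k → WeightSumsTo true i) → WeightSumsTo false k
weightSumsTo-false k ih (suc N) (s≤s 3k+1≤N) = begin
  sumTriBelow (suc N) (weight false k)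
    ≡⟨ sumTriBelow-suc (weight false k) -1ℤ (suc k) (weight true) (λ i → weight true (k ∸ i))
                       (weight-false-tri k) N ⟩
  weight false k edge + -1ℤ * sumBelow (suc k) (λ i → cauchy N (sums i) (sums (k ∸ i)))
    ≡⟨ cong (λ z → weight false k edge + -1ℤ * z) (sumBelow-cong (suc k) product-total) ⟩
  weight false k edge + -1ℤ * sumBelow (suc k) (λ i → weightTotal true i * weightTotal true (k ∸ i))
    ≡⟨ cong (λ z → weight false k edge + -1ℤ * z) (weightTotal-true-square k) ⟩
  weight false k edge + -1ℤ * weightTotal true k
    ≡⟨ edge-cancels k ⟩
  0ℤ ∎
  where
  sums : ℕ → ℕ → ℤ
  sums i a = sumTri a (weight true i)
  product-total : ∀ i → i < suc k →
    cauchy N (sums i) (sums (k ∸ i)) ≡ weightTotal true i * weightTotal true (k ∸ i)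
  product-total i (s≤s i≤k) =
    trans (cauchy-weights true i (k ∸ i) N within)
          (cong₂ _*_ (ih i≤k N (ℕₚ.≤-<-trans (ℕₚ.m≤m+n (sizeBound true i) _) within))
                     (ih (ℕₚ.m∸n≤m k i) N (ℕₚ.≤-<-trans (ℕₚ.m≤n+m _ (sizeBound true i)) within)))
    where
    within : sizeBound true i ℕ.+ sizeBound true (k ∸ i) < N
    within = subst (_≤ N) (sym (sizeBound-true-split i≤k)) 3k+1≤N
  edge-cancels : ∀ k → weight false k edge + -1ℤ * weightTotal true k ≡ 0ℤ
  edge-cancels zero    = refl
  edge-cancels (suc k) = refl

-- Coefficient k of F needs those of G below k, coefficient k of G those of F up to k.
weightSumsTo : ∀ c k → WeightSumsTo c k
weightSumsTo c k = select c (<-rec _ both k)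
  where
  select : ∀ c → WeightSumsTo true k × WeightSumsTo false k → WeightSumsTo c k
  select true  = proj₁
  select false = proj₂
  both : ∀ k → (∀ {i} → i < k → WeightSumsTo true i × WeightSumsTo false i) →
         WeightSumsTo true k × WeightSumsTo false k
  both k ih = sumsTo-true , weightSumsTo-false k earlier
    where
    sumsTo-true : WeightSumsTo true k
    sumsTo-true = weightSumsTo-true k (λ i<k → proj₂ (ih i<k))
    earlier : ∀ {i} → i ≤ k → WeightSumsTo true i
    earlier i≤k with ℕₚ.m≤n⇒m<n∨m≡n i≤k
    ... | inj₁ i<k  = proj₁ (ih i<k)
    ... | inj₂ refl = sumsTo-true

-- The substitutions t = −x and t = −x⁻¹

balance≡count-count : ∀ c τ → balance c τ ≡ + count c τ - + count (not c) τ
balance≡count-count c edge = refl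
balance≡count-count true (tri l r) =
  trans (cong₂ (λ x y → 1ℤ + x + y) (balance≡count-count false l) (balance≡count-count false r))
        (regroup (+ count false l) (+ count true l) (+ count false r) (+ count true r))
  where
  regroup : ∀ (a b c d : ℤ) → 1ℤ + (a - b) + (c - d) ≡ (1ℤ + a + c) - (b + d)
  regroup = solve-∀
balance≡count-count false (tri l r) =
  trans (cong₂ (λ x y → -1ℤ + x + y) (balance≡count-count true l) (balance≡count-count true r))
        (regroup (+ count true l) (+ count false l) (+ count true r) (+ count false r))
  where
  regroup : ∀ (a b c d : ℤ) → -1ℤ + (a - b) + (c - d) ≡ (a + c) - (1ℤ + b + d)
  regroup = solve-∀

size≡count+count : ∀ c τ → size τ ≡ count c τ ℕ.+ count (not c) τ
size≡count+count c edge = refl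
size≡count+count true (tri l r) =
  trans (cong suc (cong₂ ℕ._+_ (size≡count+count false l) (size≡count+count false r)))
        (regroup (count false l) (count true l) (count false r) (count true r))
  where
  regroup : ∀ a b c d → suc ((a ℕ.+ b) ℕ.+ (c ℕ.+ d)) ≡ suc (a ℕ.+ c) ℕ.+ (b ℕ.+ d)
  regroup = ℕ-Solver.solve-∀
size≡count+count false (tri l r) =
  trans (cong suc (cong₂ ℕ._+_ (size≡count+count true l) (size≡count+count true r)))
        (regroup (count true l) (count false l) (count true r) (count false r))
  where
  regroup : ∀ a b c d → suc ((a ℕ.+ b) ℕ.+ (c ℕ.+ d)) ≡ (a ℕ.+ c) ℕ.+ suc (b ℕ.+ d)
  regroup = ℕ-Solver.solve-∀

signPow-+ : ∀ n → signPow (+ n) ≡ -1ℤ ^ n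
signPow-+ zero          = refl
signPow-+ (suc zero)    = refl
signPow-+ (suc (suc n)) = trans (signPow-+ n) (sym (square-cancels (-1ℤ ^ n)))
  where
  square-cancels : ∀ x → -1ℤ * (-1ℤ * x) ≡ x
  square-cancels = solve-∀

signPow-⊖ : ∀ m n → signPow (m ⊖ n) ≡ -1ℤ ^ m * -1ℤ ^ n
signPow-⊖ m       zero    = trans (cong signPow (ℤₚ.⊖-≥ {m} {0} z≤n))
                                  (trans (signPow-+ m) (sym (ℤₚ.*-identityʳ _)))
signPow-⊖ zero    (suc n) = trans (signPow-+ (suc n)) (sym (ℤₚ.*-identityˡ _))
signPow-⊖ (suc m) (suc n) = begin
  signPow (suc m ⊖ suc n)          ≡⟨ cong signPow (ℤₚ.[1+m]⊖[1+n]≡m⊖n m n) ⟩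
  signPow (m ⊖ n)                  ≡⟨ signPow-⊖ m n ⟩
  -1ℤ ^ m * -1ℤ ^ n                ≡⟨ negate-both (-1ℤ ^ m) (-1ℤ ^ n) ⟩
  -1ℤ ^ suc m * -1ℤ ^ suc n        ∎
  where
  negate-both : ∀ x y → x * y ≡ (-1ℤ * x) * (-1ℤ * y)
  negate-both = solve-∀

signPow-difference : ∀ m n → signPow (+ m - + n) ≡ -1ℤ ^ m * -1ℤ ^ n
signPow-difference m n = trans (cong signPow (ℤₚ.m-n≡m⊖n m n)) (signPow-⊖ m n)

double-injective : ∀ {a b} → a ℕ.+ a ≡ b ℕ.+ b → a ≡ b
double-injective {a} {b} a+a≡b+b = ℕₚ.*-cancelˡ-≡ a b 2 (begin
  2 ℕ.* a   ≡⟨ cong (a ℕ.+_) (ℕₚ.+-identityʳ a) ⟩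
  a ℕ.+ a   ≡⟨ a+a≡b+b ⟩
  b ℕ.+ b   ≡⟨ cong (b ℕ.+_) (sym (ℕₚ.+-identityʳ b)) ⟩
  2 ℕ.* b   ∎)

even-or-not : ∀ (m : ℤ) → (Σ ℕ λ k → m ≡ + (k ℕ.+ k)) ⊎ (∀ k → m ≢ + (k ℕ.+ k))
even-or-not -[1+ j ] = inj₂ λ k ()
even-or-not (+ j) with j % 2 ℕ.≟ 0
... | yes j%2≡0 = inj₁ (j / 2 , cong +_ (begin
  j                       ≡⟨ m≡m%n+[m/n]*n j 2 ⟩
  j % 2 ℕ.+ j / 2 ℕ.* 2   ≡⟨ cong (ℕ._+ j / 2 ℕ.* 2) j%2≡0 ⟩
  j / 2 ℕ.* 2             ≡⟨ times-two (j / 2) ⟩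
  j / 2 ℕ.+ j / 2         ∎))
  where
  times-two : ∀ q → q ℕ.* 2 ≡ q ℕ.+ q
  times-two = ℕ-Solver.solve-∀
... | no j%2≢0 = inj₂ λ k j≡k+k → j%2≢0 (begin
  j % 2               ≡⟨ cong (_% 2) (ℤₚ.+-injective j≡k+k) ⟩
  (k ℕ.+ k) % 2       ≡⟨ cong (_% 2) (twice k) ⟩
  (k ℕ.* 2) % 2       ≡⟨ m*n%n≡0 k 2 ⟩
  0                   ∎)
  where
  twice : ∀ q → q ℕ.+ q ≡ q ℕ.* 2
  twice = ℕ-Solver.solve-∀

b-w≡m-[b+w]⇒m≡b+b : ∀ b w m → + b - + w ≡ m - + (b ℕ.+ w) → m ≡ + (b ℕ.+ b)
b-w≡m-[b+w]⇒m≡b+b b w m eq = begin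
  m                               ≡⟨ add-back m (+ (b ℕ.+ w)) ⟩
  (m - + (b ℕ.+ w)) + + (b ℕ.+ w) ≡⟨ cong (_+ + (b ℕ.+ w)) (sym eq) ⟩
  (+ b - + w) + (+ b + + w)       ≡⟨ cancel-w (+ b) (+ w) ⟩
  + b + + b                       ∎
  where
  add-back : ∀ (m x : ℤ) → m ≡ (m - x) + x
  add-back = solve-∀
  cancel-w : ∀ (x y : ℤ) → (x - y) + (x + y) ≡ x + x
  cancel-w = solve-∀

b-w≡[b+w]-m⇒m≡w+w : ∀ b w m → + b - + w ≡ + (b ℕ.+ w) - m → m ≡ + (w ℕ.+ w)
b-w≡[b+w]-m⇒m≡w+w b w m eq = begin
  m                                 ≡⟨ subtract-back m (+ (b ℕ.+ w)) ⟩
  + (b ℕ.+ w) - (+ (b ℕ.+ w) - m)   ≡⟨ cong (_-_ (+ (b ℕ.+ w))) (sym eq) ⟩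
  (+ b + + w) - (+ b - + w)         ≡⟨ cancel-b (+ b) (+ w) ⟩
  + w + + w                         ∎
  where
  subtract-back : ∀ (m x : ℤ) → m ≡ x - (x - m)
  subtract-back = solve-∀
  cancel-b : ∀ (x y : ℤ) → (x + y) - (x - y) ≡ y + y
  cancel-b = solve-∀

b-w≡[b+b]-[b+w] : ∀ b w → + b - + w ≡ + (b ℕ.+ b) - + (b ℕ.+ w)
b-w≡[b+b]-[b+w] b w = identity (+ b) (+ w)
  where
  identity : ∀ (x y : ℤ) → x - y ≡ (x + x) - (x + y)
  identity = solve-∀

b-w≡[b+w]-[w+w] : ∀ b w → + b - + w ≡ + (b ℕ.+ w) - + (w ℕ.+ w)
b-w≡[b+w]-[w+w] b w = identity (+ b) (+ w)
  where
  identity : ∀ (x y : ℤ) → x - y ≡ (x + y) - (y + y)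
  identity = solve-∀

nbMinusNw≡count-count : ∀ τ → nbMinusNw τ ≡ + count true τ - + count false τ
nbMinusNw≡count-count = balance≡count-count true

termMinusX-even-at : ∀ k {n} τ → size τ ≡ n →
  signPow (+ (k ℕ.+ k) - + n) * (if ⌊ nbMinusNw τ ℤ.≟ + (k ℕ.+ k) - + n ⌋ then 1ℤ else 0ℤ)
    ≡ -1ℤ ^ k * weight true k τ
termMinusX-even-at k τ refl rewrite size≡count+count true τ | nbMinusNw≡count-count τ =
  indicator-transfer (+ nb - + nw ℤ.≟ + (k ℕ.+ k) - + (nb ℕ.+ nw)) (nb ℕ.≟ k)
    (signPow (+ (k ℕ.+ k) - + (nb ℕ.+ nw))) (-1ℤ ^ nw) (-1ℤ ^ k) P→nb≡k nb≡k→P value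
  where
  nb nw : ℕ
  nb = count true τ
  nw = count false τ
  P→nb≡k : + nb - + nw ≡ + (k ℕ.+ k) - + (nb ℕ.+ nw) → nb ≡ k
  P→nb≡k eq = sym (double-injective (ℤₚ.+-injective (b-w≡m-[b+w]⇒m≡b+b nb nw _ eq)))
  nb≡k→P : nb ≡ k → + nb - + nw ≡ + (k ℕ.+ k) - + (nb ℕ.+ nw)
  nb≡k→P refl = b-w≡[b+b]-[b+w] nb nw
  value : + nb - + nw ≡ + (k ℕ.+ k) - + (nb ℕ.+ nw) →
    signPow (+ (k ℕ.+ k) - + (nb ℕ.+ nw)) ≡ -1ℤ ^ k * -1ℤ ^ nw
  value eq = trans (cong signPow (sym eq))
                   (trans (signPow-difference nb nw) (cong (λ x → -1ℤ ^ x * -1ℤ ^ nw) (P→nb≡k eq)))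

termMinusXInv-even-at : ∀ k {n} τ → size τ ≡ n →
  signPow (+ n - + (k ℕ.+ k)) * (if ⌊ nbMinusNw τ ℤ.≟ + n - + (k ℕ.+ k) ⌋ then 1ℤ else 0ℤ)
    ≡ -1ℤ ^ k * weight false k τ
termMinusXInv-even-at k τ refl rewrite size≡count+count true τ | nbMinusNw≡count-count τ =
  indicator-transfer (+ nb - + nw ℤ.≟ + (nb ℕ.+ nw) - + (k ℕ.+ k)) (nw ℕ.≟ k)
    (signPow (+ (nb ℕ.+ nw) - + (k ℕ.+ k))) (-1ℤ ^ nb) (-1ℤ ^ k) P→nw≡k nw≡k→P value
  where
  nb nw : ℕ
  nb = count true τ
  nw = count false τ
  P→nw≡k : + nb - + nw ≡ + (nb ℕ.+ nw) - + (k ℕ.+ k) → nw ≡ k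
  P→nw≡k eq = sym (double-injective (ℤₚ.+-injective (b-w≡[b+w]-m⇒m≡w+w nb nw _ eq)))
  nw≡k→P : nw ≡ k → + nb - + nw ≡ + (nb ℕ.+ nw) - + (k ℕ.+ k)
  nw≡k→P refl = b-w≡[b+w]-[w+w] nb nw
  value : + nb - + nw ≡ + (nb ℕ.+ nw) - + (k ℕ.+ k) →
    signPow (+ (nb ℕ.+ nw) - + (k ℕ.+ k)) ≡ -1ℤ ^ k * -1ℤ ^ nb
  value eq = begin
    signPow (+ (nb ℕ.+ nw) - + (k ℕ.+ k)) ≡⟨ cong signPow (sym eq) ⟩
    signPow (+ nb - + nw)                 ≡⟨ signPow-difference nb nw ⟩
    -1ℤ ^ nb * -1ℤ ^ nw                   ≡⟨ ℤₚ.*-comm (-1ℤ ^ nb) _ ⟩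
    -1ℤ ^ nw * -1ℤ ^ nb                   ≡⟨ cong (λ x → -1ℤ ^ x * -1ℤ ^ nb) (P→nw≡k eq) ⟩
    -1ℤ ^ k * -1ℤ ^ nb                   ∎

termMinusX-even : ∀ k n → termMinusX n (+ (k ℕ.+ k)) ≡ -1ℤ ^ k * sumTri n (weight true k)
termMinusX-even k n = begin
  termMinusX n (+ (k ℕ.+ k))
    ≡⟨ sym (sumℤ-*ˡ (signPow shift) indicator (triangulations n)) ⟩
  sumTri n (λ τ → signPow shift * indicator τ)
    ≡⟨ sumTri-cong n (termMinusX-even-at k) ⟩
  sumTri n (λ τ → -1ℤ ^ k * weight true k τ)
    ≡⟨ sumℤ-*ˡ (-1ℤ ^ k) (weight true k) (triangulations n) ⟩
  -1ℤ ^ k * sumTri n (weight true k) ∎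
  where
  shift : ℤ
  shift = + (k ℕ.+ k) - + n
  indicator : Triangulation → ℤ
  indicator τ = if ⌊ nbMinusNw τ ℤ.≟ shift ⌋ then 1ℤ else 0ℤ

termMinusXInv-even : ∀ k n → termMinusXInv n (+ (k ℕ.+ k)) ≡ -1ℤ ^ k * sumTri n (weight false k)
termMinusXInv-even k n = begin
  termMinusXInv n (+ (k ℕ.+ k))
    ≡⟨ sym (sumℤ-*ˡ (signPow shift) indicator (triangulations n)) ⟩
  sumTri n (λ τ → signPow shift * indicator τ)
    ≡⟨ sumTri-cong n (termMinusXInv-even-at k) ⟩
  sumTri n (λ τ → -1ℤ ^ k * weight false k τ)
    ≡⟨ sumℤ-*ˡ (-1ℤ ^ k) (weight false k) (triangulations n) ⟩
  -1ℤ ^ k * sumTri n (weight false k) ∎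
  where
  shift : ℤ
  shift = + n - + (k ℕ.+ k)
  indicator : Triangulation → ℤ
  indicator τ = if ⌊ nbMinusNw τ ℤ.≟ shift ⌋ then 1ℤ else 0ℤ

termMinusX-not-even : ∀ m → (∀ k → m ≢ + (k ℕ.+ k)) → ∀ n → termMinusX n m ≡ 0ℤ
termMinusX-not-even m m-not-even n =
  trans (cong (signPow (m - + n) *_) (trans (sumTri-cong n vanishes) (sumℤ-0 (triangulations n))))
        (ℤₚ.*-zeroʳ (signPow (m - + n)))
  where
  vanishes : ∀ τ → size τ ≡ n → (if ⌊ nbMinusNw τ ℤ.≟ m - + n ⌋ then 1ℤ else 0ℤ) ≡ 0ℤ
  vanishes τ refl = if-no (nbMinusNw τ ℤ.≟ _) λ eq →
    m-not-even (count true τ) (b-w≡m-[b+w]⇒m≡b+b (count true τ) (count false τ) m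
      (trans (sym (nbMinusNw≡count-count τ)) (trans eq (cong (λ n → m - + n) (size≡count+count true τ)))))

termMinusXInv-not-even : ∀ m → (∀ k → m ≢ + (k ℕ.+ k)) → ∀ n → termMinusXInv n m ≡ 0ℤ
termMinusXInv-not-even m m-not-even n =
  trans (cong (signPow (+ n - m) *_) (trans (sumTri-cong n vanishes) (sumℤ-0 (triangulations n))))
        (ℤₚ.*-zeroʳ (signPow (+ n - m)))
  where
  vanishes : ∀ τ → size τ ≡ n → (if ⌊ nbMinusNw τ ℤ.≟ + n - m ⌋ then 1ℤ else 0ℤ) ≡ 0ℤ
  vanishes τ refl = if-no (nbMinusNw τ ℤ.≟ _) λ eq →
    m-not-even (count false τ) (b-w≡[b+w]-m⇒m≡w+w (count true τ) (count false τ) m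
      (trans (sym (nbMinusNw≡count-count τ)) (trans eq (cong (λ n → + n - m) (size≡count+count true τ)))))

sumsTo-weights : ∀ (term : ℕ → ℤ → ℤ) (target : ℤ → ℤ) c →
  (∀ k n → term n (+ (k ℕ.+ k)) ≡ -1ℤ ^ k * sumTri n (weight c k)) →
  (∀ m → (∀ k → m ≢ + (k ℕ.+ k)) → ∀ n → term n m ≡ 0ℤ) →
  (∀ k → -1ℤ ^ k * weightTotal c k ≡ target (+ (k ℕ.+ k))) →
  (∀ m → (∀ k → m ≢ + (k ℕ.+ k)) → target m ≡ 0ℤ) →
  SumsTo term target
sumsTo-weights term target c term-even term-not-even target-even target-not-even m with even-or-not m
... | inj₂ m-not-even = 0 , (λ n _ → term-not-even m m-not-even n) , sym (target-not-even m m-not-even)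
... | inj₁ (k , refl) = suc (sizeBound c k) , vanishes , sums
  where
  vanishes : ∀ n → suc (sizeBound c k) ≤ n → term n (+ (k ℕ.+ k)) ≡ 0ℤ
  vanishes n bound = trans (term-even k n)
                           (trans (cong (-1ℤ ^ k *_) (sumTri-weight-beyond c k n bound))
                                  (ℤₚ.*-zeroʳ (-1ℤ ^ k)))
  sums : sumBelow (suc (sizeBound c k)) (λ n → term n (+ (k ℕ.+ k))) ≡ target (+ (k ℕ.+ k))
  sums = begin
    sumBelow (suc (sizeBound c k)) (λ n → term n (+ (k ℕ.+ k)))
      ≡⟨ sumBelow-cong (suc (sizeBound c k)) (λ n _ → term-even k n) ⟩
    sumBelow (suc (sizeBound c k)) (λ n → -1ℤ ^ k * sumTri n (weight c k))
      ≡⟨ sumBelow-*ˡ (suc (sizeBound c k)) (-1ℤ ^ k) (λ n → sumTri n (weight c k)) ⟩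
    -1ℤ ^ k * sumTriBelow (suc (sizeBound c k)) (weight c k)
      ≡⟨ cong (-1ℤ ^ k *_) (weightSumsTo c k _ ℕₚ.≤-refl) ⟩
    -1ℤ ^ k * weightTotal c k
      ≡⟨ target-even k ⟩
    target (+ (k ℕ.+ k)) ∎

oneSeries-even : ∀ k → -1ℤ ^ k * weightTotal true k ≡ oneSeries (+ (k ℕ.+ k))
oneSeries-even zero    = refl
oneSeries-even (suc k) = ℤₚ.*-zeroʳ (-1ℤ ^ suc k)

oneSeries-not-even : ∀ m → (∀ k → m ≢ + (k ℕ.+ k)) → oneSeries m ≡ 0ℤ
oneSeries-not-even m m-not-even = if-no (m ℤ.≟ 0ℤ) (m-not-even 0)

proposition4p6 : SumsTo termMinusX oneSeries × SumsTo termMinusXInv zeroSeries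
proposition4p6 =
  sumsTo-weights termMinusX oneSeries true termMinusX-even termMinusX-not-even
                 oneSeries-even oneSeries-not-even ,
  sumsTo-weights termMinusXInv zeroSeries false termMinusXInv-even termMinusXInv-not-even
                 (λ k → ℤₚ.*-zeroʳ (-1ℤ ^ k)) (λ _ _ → refl)
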